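{- Let $d\ge 2$ and assume that for all finite families $\mathcal{G}\subseteq\binom{\mathbb{N}}{d-1}$ one has $\mathrm{Inc}(\mathcal{C}(\mathcal{G}))\subseteq\mathcal{C}(\mathrm{Inc}(\mathcal{G}))$. Then: (i) for all $k\in\mathbb{N}$ and all finite families $\mathcal{G}\subseteq\binom{\mathbb{N}_{>k}}{d-1}$ one has $\mathrm{Inc}(\mathcal{C}_{>k}(\mathcal{G}))\subseteq \mathcal{C}_{>k}(\mathrm{Inc}(\mathcal{G}))$; (ii) for all finite families $\mathcal{F}\subseteq \binom{\mathbb{N}}{d}$ one has $\mathrm{Inc}(\mathcal{C}^{(l)}(\mathcal{F}))\subseteq \mathcal{C}^{(l)}(\mathrm{Inc}(\mathcal{F}))$ and $\mathrm{Inc}(\mathcal{C}^{(r)}(\mathcal{F}))\subseteq \mathcal{C}^{(r)}(\mathrm{Inc}(\mathcal{F}))$.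
   Context: $\mathbb{N}=\{1,2,\dots\}$, $\mathbb{N}_{>k}=\{n\in\mathbb{N}:n>k\}$; $e$-subsets are written $\mathbf{u}=(u_1,\dots,u_e)$ with $u_1<\dots<u_e$. Squashed order: $\mathbf{u}<\mathbf{v}$ if the largest element of the symmetric difference lies in $\mathbf{v}$. For finite $\mathcal{A}\subseteq\binom{\mathbb{N}}{e}$, $\mathcal{C}(\mathcal{A})$ is the set of the $|\mathcal{A}|$ smallest elements of $\binom{\mathbb{N}}{e}$; for $\mathcal{A}\subseteq\binom{\mathbb{N}_{>k}}{e}$, $\mathcal{C}_{>k}(\mathcal{A})$ is the set of the $|\mathcal{A}|$ smallest elements of $\binom{\mathbb{N}_{>k}}{e}$. $\mathrm{Inc}_1$ is the set of maps $\pi:\mathbb{N}\to\mathbb{N}$ with $\pi(j)<\pi(j+1)$, $\pi(j)\le j+1$ for all $j$, acting by $\pi(\mathbf{u})=(\pi(u_1),\dots,\pi(u_e))$; $\mathrm{Inc}(\mathcal{A})=\{\pi(\mathbf{u})\mid\mathbf{u}\in\mathcal{A},\pi\in\mathrm{Inc}_1\}$. For finite $\mathcal{F}\subseteq\binom{\mathbb{N}}{d}$ and $k\ge1$: $\widehat{\mathcal{F}}_{1,k}=\{\widehat{\mathbf{u}}\in\binom{\mathbb{N}}{d-1}\mid \{k\}\cup\widehat{\mathbf{u}}\in\mathcal{F},\ k<\min\widehat{\mathbf{u}}\}$, $\widehat{\mathcal{F}}_{d,k}=\{\widehat{\mathbf{u}}\in\binom{\mathbb{N}}{d-1}\mid \widehat{\mathbf{u}}\cup\{k\}\in\mathcal{F},\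 \max\widehat{\mathbf{u}}<k\}$. Left partial compression: $\mathcal{C}^{(l)}(\mathcal{F})=\{\{k\}\cup\widehat{\mathbf{u}}\mid k\ge1,\ \widehat{\mathbf{u}}\in\mathcal{C}_{>k}(\widehat{\mathcal{F}}_{1,k})\}$; right partial compression: $\mathcal{C}^{(r)}(\mathcal{F})=\{\widehat{\mathbf{u}}\cup\{k\}\mid k\ge1,\ \widehat{\mathbf{u}}\in\mathcal{C}(\widehat{\mathcal{F}}_{d,k})\}$. -}

module Defs where

open import Level using (0ℓ)
open import Data.Nat using (ℕ; zero; suc; _≤_; _<_; _∸_)
open import Data.List using (List; []; _∷_; length; map; _++_; [_])
open import Data.List.Relation.Unary.All using (All)
open import Data.List.Relation.Unary.Linked using (Linked)
open import Data.List.Relation.Unary.Unique.Propositional using (Unique)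
open import Data.List.Membership.Propositional using (_∈_; _∉_)
open import Data.Product using (Σ; ∃; ∃-syntax; _×_; _,_)
open import Function.Bundles using (_⇔_)
open import Relation.Nullary using (¬_)
open import Relation.Binary.PropositionalEquality using (_≡_)

-- A finite subset of ℕ = {1,2,...} is represented by the strictly
-- increasing list of its elements.  An e-subset u = (u₁,...,u_e).
Sub : Set
Sub = List ℕ

IsESub : ℕ → Sub → Set
IsESub e u = length u ≡ e × All (1 ≤_) u × Linked _<_ u

IsESubGt : ℕ → ℕ → Sub → Set
IsESubGt k e u = IsESub e u × All (k <_) u

Fam : Set₁
Fam = Sub → Set

_⊆F_ : Fam → Fam → Set
A ⊆F B = ∀ u → A u → B u

HasCard : Fam → ℕ → Set
HasCard A n = Σ (List Sub) λ L → Unique L × length L ≡ n × (∀ v → A v ⇔ v ∈ L)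

Finite : Fam → Set
Finite A = ∃[ n ] HasCard A n

_≺_ : Sub → Sub → Set
u ≺ v = ∃[ x ] (x ∈ v × x ∉ u × (∀ y → x < y → (y ∈ u ⇔ y ∈ v)))

Smallest : Fam → ℕ → Fam
Smallest U n u = U u × ¬ (Σ (List Sub) λ L → Unique L × length L ≡ n × All (λ v → U v × v ≺ u) L)

C : ℕ → Fam → Fam
C e A u = ∃[ n ] (HasCard A n × Smallest (IsESub e) n u)

Cgt : ℕ → ℕ → Fam → Fam
Cgt k e A u = ∃[ n ] (HasCard A n × Smallest (IsESubGt k e) n u)

IsInc1 : (ℕ → ℕ) → Set
IsInc1 π = ∀ j → 1 ≤ j → (1 ≤ π j × π j < π (suc j) × π j ≤ suc j)

Inc : Fam → Fam
Inc A v = ∃[ u ] (A u × ∃[ π ] (IsInc1 π × v ≡ map π u))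

Hat1 : ℕ → ℕ → Fam → Fam
Hat1 d k F û = IsESub (d ∸ 1) û × F (k ∷ û) × All (k <_) û

Hatd : ℕ → ℕ → Fam → Fam
Hatd d k F û = IsESub (d ∸ 1) û × F (û ++ [ k ]) × All (_< k) û

Cl : ℕ → Fam → Fam
Cl d F w = ∃[ k ] (1 ≤ k × ∃[ û ] (w ≡ k ∷ û × Cgt k (d ∸ 1) (Hat1 d k F) û))

Cr : ℕ → Fam → Fam
Cr d F w = ∃[ k ] (1 ≤ k × ∃[ û ] (w ≡ û ++ [ k ] × C (d ∸ 1) (Hatd d k F) û))

FamOf : ℕ → Fam → Set
FamOf e A = ∀ u → A u → IsESub e u

FamOfGt : ℕ → ℕ → Fam → Set
FamOfGt k e A = ∀ u → A u → IsESubGt k e u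

module Submission where

-- The basic observation is that a map π ∈ Inc₁ acts on an increasing list
-- of positive integers like an insertion map  cut t  (identity below t,
-- successor from t on); so Inc(A) = { cut t (u) | u ∈ A }, and Inc(A) is
-- finite whenever A is.  A counting argument shows that the |A| smallest
-- elements are among the |B| smallest whenever A injects into B.
--
-- (i)  Translation by k is an order isomorphism from the e-subsets of ℕ onto
--      those of ℕ_{>k} which commutes with the insertion maps; it therefore
--      carries C to C_{>k} and Inc to Inc, and (i) is the hypothesis
--      transported along it.
-- (ii) For w = π(k ∪ û) resp. w = π(û ∪ k) we distinguish π(k) = k and
--      π(k) = k+1.  In each case π(û) (or a translate of û) lies in the
--      compression of a section of F, by (i) or by the hypothesis, and that
--      section injects into the corresponding section of Inc(F).

open import Defs
open import Data.Nat using (ℕ; zero; suc; _≤_; _<_; _∸_; _+_; _⊓_; z≤n; s≤s; _<?_; _≤?_; _≟_; _≤′_; ≤′-refl; ≤′-step)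
open import Data.Nat.Properties
open import Data.List using (List; []; _∷_; length; map; _++_; [_]; concat; filter; deduplicate; take; drop; applyUpTo)
open import Data.List.Properties using (length-map; map-++; ≡-dec; length-take; length-++; map-injective; map-id; map-id-local; map-cong-local)
open import Data.List.Extrema.Nat using (max; xs≤max; argmax-sel)
open import Data.List.Relation.Unary.All as All using (All; []; _∷_)
import Data.List.Relation.Unary.All.Properties as AllP
open import Data.List.Relation.Unary.AllPairs using ([]; _∷_)
open import Data.List.Relation.Unary.Linked as Linked using (Linked; []; [-]; _∷_)
import Data.List.Relation.Unary.Linked.Properties as LinkedP
open import Data.List.Relation.Unary.Any using (here; there)
open import Data.List.Relation.Unary.Unique.Propositional using (Unique)
import Data.List.Relation.Unary.Unique.Propositional.Properties as UniqueP
import Data.List.Relation.Unary.Unique.DecPropositional.Properties as UniqueDecP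
open import Data.List.Membership.Propositional using (_∈_; _∉_; find)
open import Data.List.Membership.Propositional.Properties
import Data.List.Membership.DecPropositional as DecMembership
open import Data.Product using (∃-syntax; _×_; _,_; proj₁; proj₂)
open import Data.Sum using (_⊎_; inj₁; inj₂)
open import Data.Empty using (⊥-elim)
open import Function using (id)
open import Function.Bundles using (_⇔_; mk⇔; Equivalence)
open import Relation.Nullary using (¬_; yes; no; contradiction; Dec)
open import Relation.Nullary.Decidable using (_×-dec_; map′)
open import Relation.Unary using (Decidable)
open import Relation.Binary.PropositionalEquality hiding ([_])

open Equivalence using (to; from)

-- Insertion maps

cut : ℕ → ℕ → ℕ
cut t j with j <? t
... | yes _ = j
... | no _ = suc j

cut-lt : ∀ {t j} → j < t → cut t j ≡ j
cut-lt {t} {j} j<t with j <? t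
... | yes _ = refl
... | no j≮t = contradiction j<t j≮t

cut-ge : ∀ {t j} → t ≤ j → cut t j ≡ suc j
cut-ge {t} {j} t≤j with j <? t
... | yes j<t = contradiction t≤j (<⇒≱ j<t)
... | no _ = refl

cut-≥ : ∀ t j → j ≤ cut t j
cut-≥ t j with j <? t
... | yes _ = ≤-refl
... | no _ = n≤1+n j

cut-≤ : ∀ t j → cut t j ≤ suc j
cut-≤ t j with j <? t
... | yes _ = n≤1+n j
... | no _ = ≤-refl

cut-mono : ∀ t {a b} → a < b → cut t a < cut t b
cut-mono t {a} {b} a<b with a <? t | b <? t
... | yes _ | yes _ = a<b
... | yes _ | no _ = m<n⇒m<1+n a<b
... | no a≮t | yes b<t = contradiction (<-trans a<b b<t) a≮t
... | no _ | no _ = s≤s a<b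

cut-isInc1 : ∀ t → IsInc1 (cut t)
cut-isInc1 t j 1≤j = ≤-trans 1≤j (cut-≥ t j) , cut-mono t (n<1+n j) , cut-≤ t j

cut-⊓ : ∀ t {k j} → j < k → cut (t ⊓ k) j ≡ cut t j
cut-⊓ t {k} {j} j<k with <-≤-connex j t
... | inj₁ j<t = trans (cut-lt (⊓-pres-m< j<t j<k)) (sym (cut-lt j<t))
... | inj₂ t≤j = trans (cut-ge (≤-trans (m⊓n≤m t k) t≤j)) (sym (cut-ge t≤j))

cut-+ : ∀ s t j → s + cut t j ≡ cut (s + t) (s + j)
cut-+ s t j with <-≤-connex j t
... | inj₁ j<t = trans (cong (s +_) (cut-lt j<t)) (sym (cut-lt (+-monoʳ-< s j<t)))
... | inj₂ t≤j = trans (cong (s +_) (cut-ge t≤j)) (trans (+-suc s j) (sym (cut-ge (+-monoʳ-≤ s t≤j))))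

map-cut-ge : ∀ {t u} → All (t ≤_) u → map (cut t) u ≡ map suc u
map-cut-ge t≤u = map-cong-local (All.map cut-ge t≤u)

-- Maps of Inc₁ act as insertion maps

head<tail : ∀ {y ys} → Linked _<_ (y ∷ ys) → All (y <_) ys
head<tail [-] = []
head<tail (y<z ∷ lk) = LinkedP.Linked⇒All <-trans y<z lk

module _ {π : ℕ → ℕ} (hπ : IsInc1 π) where

  inc1-≥ : ∀ j → 1 ≤ j → j ≤ π j
  inc1-≥ (suc zero) _ = proj₁ (hπ 1 ≤-refl)
  inc1-≥ (suc (suc i)) _ = ≤-trans (s≤s (inc1-≥ (suc i) (s≤s z≤n))) (proj₁ (proj₂ (hπ (suc i) (s≤s z≤n))))

  inc1-cases : ∀ j → 1 ≤ j → π j ≡ j ⊎ π j ≡ suc j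
  inc1-cases j 1≤j with m≤n⇒m<n∨m≡n (inc1-≥ j 1≤j)
  ... | inj₂ j≡πj = inj₁ (sym j≡πj)
  ... | inj₁ j<πj = inj₂ (≤-antisym (proj₂ (proj₂ (hπ j 1≤j))) j<πj)

  inc1-moved-above : ∀ {x y} → 1 ≤ x → π x ≡ suc x → x ≤ y → π y ≡ suc y
  inc1-moved-above {x} 1≤x moved x≤y = go (≤⇒≤′ x≤y)
    where
    go : ∀ {y} → x ≤′ y → π y ≡ suc y
    go ≤′-refl = moved
    go {suc y} (≤′-step x≤′y) =
      ≤-antisym (proj₂ (proj₂ (hπ (suc y) (s≤s z≤n))))
                (subst (_< π (suc y)) (go x≤′y) (proj₁ (proj₂ (hπ y (≤-trans 1≤x (≤′⇒≤ x≤′y))))))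

  inc1-shifts-above : ∀ {x u} → 1 ≤ x → π x ≡ suc x → All (x ≤_) u → map π u ≡ map suc u
  inc1-shifts-above 1≤x moved x≤u = map-cong-local (All.map (inc1-moved-above 1≤x moved) x≤u)

  inc1-fixes-below : ∀ {k u} → π k ≡ k → All (1 ≤_) u → All (_< k) u → map π u ≡ u
  inc1-fixes-below {k} fixed pos u<k = map-id-local (All.zipWith fixes (pos , u<k))
    where
    fixes : ∀ {j} → 1 ≤ j × j < k → π j ≡ j
    fixes {j} (1≤j , j<k) with inc1-cases j 1≤j
    ... | inj₁ πj≡j = πj≡j
    ... | inj₂ moved = contradiction (trans (sym (inc1-moved-above 1≤j moved (<⇒≤ j<k))) fixed) 1+n≢n

  inc1-as-cut : ∀ x u → Linked _<_ u → All (x <_) u → ∃[ t ] (x < t × map π u ≡ map (cut t) u)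
  inc1-as-cut x [] _ _ = suc x , ≤-refl , refl
  inc1-as-cut x (y ∷ ys) lk (x<y ∷ _) with inc1-cases y (≤-trans (s≤s z≤n) x<y)
  ... | inj₂ moved = y , x<y ,
        trans (inc1-shifts-above (≤-trans (s≤s z≤n) x<y) moved y≤u) (sym (map-cut-ge y≤u))
    where
    y≤u : All (y ≤_) (y ∷ ys)
    y≤u = ≤-refl ∷ All.map <⇒≤ (head<tail lk)
  ... | inj₁ fixed with inc1-as-cut y ys (Linked.tail lk) (head<tail lk)
  ... | t , y<t , eq = t , <-trans x<y y<t , cong₂ _∷_ (trans fixed (sym (cut-lt y<t))) eq

Inc-normal : ∀ {A : Fam} {k e v} → FamOfGt k e A → Inc A v → ∃[ u ] (A u × ∃[ t ] (k < t × v ≡ map (cut t) u))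
Inc-normal {k = k} famA (u , au , π , hπ , refl) with famA u au
... | (_ , _ , lk) , k<u with inc1-as-cut hπ k u lk k<u
... | t , k<t , eq = u , au , t , k<t , eq

cut-∈Inc : ∀ {A : Fam} {u} t → A u → Inc A (map (cut t) u)
cut-∈Inc t au = _ , au , cut t , cut-isInc1 t , refl

FamOf⇒FamOfGt0 : ∀ {e A} → FamOf e A → FamOfGt 0 e A
FamOf⇒FamOfGt0 famA u au = famA u au , proj₁ (proj₂ (famA u au))

Inc-mono : ∀ {A B : Fam} → A ⊆F B → Inc A ⊆F Inc B
Inc-mono A⊆B v (u , au , π) = u , A⊆B u au , π

-- Counting

InjectiveOn : Fam → (Sub → Sub) → Set
InjectiveOn A f = ∀ {a b} → A a → A b → f a ≡ f b → a ≡ b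

unique-length : ∀ {xs ys : List Sub} → Unique xs → (∀ {z} → z ∈ xs → z ∈ ys) → length xs ≤ length ys
unique-length {[]} _ _ = z≤n
unique-length {x ∷ xs} {ys} (x∉xs ∷ uxs) xs⊆ys with ∈-∃++ (xs⊆ys (here refl))
... | as , bs , refl = subst (suc (length xs) ≤_) (sym length-without-x) (s≤s (unique-length uxs xs⊆as++bs))
  where
  length-without-x : length (as ++ [ x ] ++ bs) ≡ suc (length (as ++ bs))
  length-without-x = trans (length-++ as) (trans (+-suc (length as) (length bs)) (cong suc (sym (length-++ as))))
  xs⊆as++bs : ∀ {z} → z ∈ xs → z ∈ as ++ bs
  xs⊆as++bs {z} z∈xs with ∈-++⁻ as (xs⊆ys (there z∈xs))
  ... | inj₁ z∈as = ∈-++⁺ˡ z∈as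
  ... | inj₂ (here refl) = contradiction refl (All.lookup x∉xs z∈xs)
  ... | inj₂ (there z∈bs) = ∈-++⁺ʳ as z∈bs

unique-map-on : ∀ {A : Fam} (f : Sub → Sub) → InjectiveOn A f → ∀ {L} → All A L → Unique L → Unique (map f L)
unique-map-on f inj [] [] = []
unique-map-on {A} f inj {x ∷ L} (ax ∷ aL) (x∉L ∷ uL) = AllP.map⁺ (distinct aL x∉L) ∷ unique-map-on f inj aL uL
  where
  distinct : ∀ {L} → All A L → All (λ y → ¬ x ≡ y) L → All (λ y → ¬ f x ≡ f y) L
  distinct [] [] = []
  distinct (ay ∷ aL) (x≢y ∷ x∉L) = (λ fx≡fy → x≢y (inj ax ay fx≡fy)) ∷ distinct aL x∉L

card-≤ : ∀ {A B : Fam} {n m} → HasCard A n → HasCard B m → (f : Sub → Sub) →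
         (∀ u → A u → B (f u)) → InjectiveOn A f → n ≤ m
card-≤ (LA , uA , refl , hA) (LB , uB , refl , hB) f A→B inj =
  subst (_≤ length LB) (length-map f LA) (unique-length (unique-map-on f inj aLA uA) fLA⊆LB)
  where
  aLA = All.tabulate (λ {x} → from (hA x))
  fLA⊆LB : ∀ {z} → z ∈ map f LA → z ∈ LB
  fLA⊆LB z∈ with ∈-map⁻ f z∈
  ... | x , x∈LA , refl = to (hB (f x)) (A→B x (from (hA x) x∈LA))

HasCard-image : ∀ {A B : Fam} {n} (f : Sub → Sub) → InjectiveOn A f →
                (∀ v → B v ⇔ (∃[ u ] (A u × v ≡ f u))) → HasCard A n → HasCard B n
HasCard-image {A} {B} f inj B≡fA (L , uL , len , hL) =
  map f L , unique-map-on f inj (All.tabulate (λ {x} → from (hL x))) uL , trans (length-map f L) len ,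
  λ v → mk⇔ (into v) (outof v)
  where
  into : ∀ v → B v → v ∈ map f L
  into v bv with to (B≡fA v) bv
  ... | u , au , refl = ∈-map⁺ f (to (hL u) au)
  outof : ∀ v → v ∈ map f L → B v
  outof v v∈ with ∈-map⁻ f v∈
  ... | u , u∈L , refl = from (B≡fA v) (u , from (hL u) u∈L , refl)

smallest-resp : ∀ {U V : Fam} {n u} → (∀ v → U v ⇔ V v) → Smallest U n u → Smallest V n u
smallest-resp U⇔V (uu , notAbove) =
  to (U⇔V _) uu , λ (L , uL , len , below) → notAbove (L , uL , len , All.map (λ (vv , v≺u) → from (U⇔V _) vv , v≺u) below)

smallest-≤ : ∀ {U n m u} → n ≤ m → Smallest U n u → Smallest U m u
smallest-≤ {n = n} n≤m (uu , notAbove) = uu , λ (L , uL , len , below) →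
  notAbove (take n L , UniqueP.take⁺ n uL ,
            trans (length-take n L) (trans (cong (n ⊓_) len) (m≤n⇒m⊓n≡m n≤m)) , AllP.take⁺ n below)

smallest-grow : ∀ {A B U : Fam} {u} → Finite B → (f : Sub → Sub) →
                (∀ v → A v → B (f v)) → InjectiveOn A f →
                ∃[ n ] (HasCard A n × Smallest U n u) → ∃[ m ] (HasCard B m × Smallest U m u)
smallest-grow (m , hcB) f A→B inj (n , hcA , sm) = m , hcB , smallest-≤ (card-≤ hcA hcB f A→B inj) sm

-- If w has an entry y ≥ k, every v with entries below k precedes w:
-- the largest entry of w is not in v, and nothing above it is in v or w.
≺-above : ∀ {w v : Sub} {k y} → y ∈ w → k ≤ y → All (_< k) v → v ≺ w
≺-above {w} {v} {k} {y} y∈w k≤y v<k = x , x∈w , x∉v , λ z x<z → mk⇔ (λ z∈v → ⊥-elim (z∉v z x<z z∈v)) (λ z∈w → ⊥-elim (z∉w z x<z z∈w))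
  where
  x = max 0 w
  y≤x : y ≤ x
  y≤x = All.lookup (xs≤max 0 w) y∈w
  x∈w : x ∈ w
  x∈w with argmax-sel id 0 w
  ... | inj₂ x∈w = x∈w
  ... | inj₁ x≡0 = subst (_∈ w) (trans (n≤0⇒n≡0 (subst (y ≤_) x≡0 y≤x)) (sym x≡0)) y∈w
  x∉v : x ∉ v
  x∉v x∈v = <⇒≱ (All.lookup v<k x∈v) (≤-trans k≤y y≤x)
  z∉v : ∀ z → x < z → z ∉ v
  z∉v z x<z z∈v = <⇒≱ (All.lookup v<k z∈v) (≤-trans (≤-trans k≤y y≤x) (<⇒≤ x<z))
  z∉w : ∀ z → x < z → z ∉ w
  z∉w z x<z z∈w = <⇒≱ x<z (All.lookup (xs≤max 0 w) z∈w)

smallest-below : ∀ {U G : Fam} {n w k} → Smallest U n w → HasCard G n → G ⊆F U →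
                 (∀ v → G v → All (_< k) v) → All (_< k) w
smallest-below {U} {w = w} {k} (_ , notAbove) (L , uL , len , hL) G⊆U G<k with All.all? (_<? k) w
... | yes w<k = w<k
... | no w≮k with find (AllP.¬All⇒Any¬ (_<? k) w w≮k)
... | y , y∈w , y≮k = contradiction (L , uL , len , All.tabulate below) notAbove
  where
  below : ∀ {v} → v ∈ L → U v × v ≺ w
  below {v} v∈L = G⊆U v (from (hL v) v∈L) , ≺-above y∈w (≮⇒≥ y≮k) (G<k v (from (hL v) v∈L))

-- Finiteness

_≟Sub_ : (a b : Sub) → Dec (a ≡ b)
_≟Sub_ = ≡-dec _≟_

Listed : Fam → List Sub → Set
Listed A K = ∀ v → A v ⇔ v ∈ K

listed⇒finite : ∀ {A K} → Listed A K → Finite A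
listed⇒finite {K = K} hK = length D , D , UniqueDecP.deduplicate-! _≟Sub_ K , refl ,
  λ v → mk⇔ (λ av → ∈-deduplicate⁺ _≟Sub_ (to (hK v) av)) (λ v∈D → from (hK v) (∈-deduplicate⁻ _≟Sub_ K v∈D))
  where D = deduplicate _≟Sub_ K

finite-dec : ∀ {A} → Finite A → Decidable A
finite-dec (_ , K , _ , _ , hK) v = map′ (from (hK v)) (to (hK v)) (DecMembership._∈?_ _≟Sub_ v K)

finite-filter : ∀ {P : Fam} → Decidable P → (cand : List Sub) → (∀ v → P v → v ∈ cand) → Finite P
finite-filter P? cand P⊆cand = listed⇒finite λ v →
  mk⇔ (λ pv → ∈-filter⁺ P? (P⊆cand v pv) pv) (λ v∈ → proj₂ (∈-filter⁻ P? {xs = cand} v∈))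

isESub? : ∀ e → Decidable (IsESub e)
isESub? e u = (length u ≟ e) ×-dec (All.all? (1 ≤?_) u ×-dec Linked.linked? _<?_ u)

finite-Hat1 : ∀ {A} d k → Finite A → Finite (Hat1 d k A)
finite-Hat1 {A} d k finA@(_ , K , _ , _ , hK) =
  finite-filter Hat1? (map (drop 1) K) (λ v (_ , a , _) → ∈-map⁺ (drop 1) (to (hK _) a))
  where
  Hat1? : Decidable (Hat1 d k A)
  Hat1? v = isESub? (d ∸ 1) v ×-dec (finite-dec finA (k ∷ v) ×-dec All.all? (k <?_) v)

dropLast : Sub → Sub
dropLast [] = []
dropLast (x ∷ []) = []
dropLast (x ∷ y ∷ ys) = x ∷ dropLast (y ∷ ys)

dropLast-snoc : ∀ v k → dropLast (v ++ [ k ]) ≡ v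
dropLast-snoc [] k = refl
dropLast-snoc (x ∷ []) k = refl
dropLast-snoc (x ∷ y ∷ v) k = cong (x ∷_) (dropLast-snoc (y ∷ v) k)

finite-Hatd : ∀ {A} d k → Finite A → Finite (Hatd d k A)
finite-Hatd {A} d k finA@(_ , K , _ , _ , hK) =
  finite-filter Hatd? (map dropLast K)
    (λ v (_ , a , _) → subst (_∈ map dropLast K) (dropLast-snoc v k) (∈-map⁺ dropLast (to (hK _) a)))
  where
  Hatd? : Decidable (Hatd d k A)
  Hatd? v = isESub? (d ∸ 1) v ×-dec (finite-dec finA (v ++ [ k ]) ×-dec All.all? (_<? k) v)

-- The images of u under the insertion maps cut t with t ≤ max u + 1;
-- by cut-⊓ these are all images of u under insertion maps.
insertions : Sub → List Sub
insertions u = applyUpTo (λ t → map (cut t) u) (suc (suc (max 0 u)))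

insertions-complete : ∀ t u → map (cut t) u ∈ insertions u
insertions-complete t u = subst (_∈ insertions u) capped
  (∈-applyUpTo⁺ (λ t → map (cut t) u) (s≤s (m⊓n≤n t (suc (max 0 u)))))
  where
  capped : map (cut (t ⊓ suc (max 0 u))) u ≡ map (cut t) u
  capped = map-cong-local (All.map (λ j≤max → cut-⊓ t (s≤s j≤max)) (xs≤max 0 u))

finite-Inc : ∀ {A} e → FamOf e A → Finite A → Finite (Inc A)
finite-Inc {A} e famA (_ , K , _ , _ , hK) = listed⇒finite λ v → mk⇔ (into v) (outof v)
  where
  into : ∀ v → Inc A v → v ∈ concat (map insertions K)
  into v incv with Inc-normal (FamOf⇒FamOfGt0 famA) incv
  ... | u , au , t , _ , refl = ∈-concat⁺′ (insertions-complete t u) (∈-map⁺ insertions (to (hK u) au))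
  outof : ∀ v → v ∈ concat (map insertions K) → Inc A v
  outof v v∈ with ∈-concat⁻′ (map insertions K) v∈
  ... | _ , v∈ins , ins∈ with ∈-map⁻ insertions ins∈
  ... | u , u∈K , refl with ∈-applyUpTo⁻ (λ t → map (cut t) u) v∈ins
  ... | t , _ , refl = cut-∈Inc t (from (hK u) u∈K)

-- Translation

shift : ℕ → Sub → Sub
shift s = map (s +_)

shift-cut : ∀ s t u → shift s (map (cut t) u) ≡ map (cut (s + t)) (shift s u)
shift-cut s t [] = refl
shift-cut s t (j ∷ u) = cong₂ _∷_ (cut-+ s t j) (shift-cut s t u)

unshift : ℕ → Sub → Sub
unshift s = map (_∸ s)

_↓_ : Fam → ℕ → Fam
(A ↓ k) v = A (shift k v)

shift-injective : ∀ s {a b} → shift s a ≡ shift s b → a ≡ b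
shift-injective s = map-injective (+-cancelˡ-≡ s _ _)

unshift-shift : ∀ s u → unshift s (shift s u) ≡ u
unshift-shift s [] = refl
unshift-shift s (x ∷ u) = cong₂ _∷_ (m+n∸m≡n s x) (unshift-shift s u)

shift-unshift : ∀ s {v} → All (s ≤_) v → shift s (unshift s v) ≡ v
shift-unshift s [] = refl
shift-unshift s (s≤x ∷ s≤v) = cong₂ _∷_ (m+[n∸m]≡n s≤x) (shift-unshift s s≤v)

Gt-above : ∀ {b e v s} → IsESubGt b e v → s ≤ b → All (s ≤_) v
Gt-above (_ , b<v) s≤b = All.map (λ b<x → ≤-trans s≤b (<⇒≤ b<x)) b<v

shift-Gt⁺ : ∀ {a e u} s → IsESubGt a e u → IsESubGt (s + a) e (shift s u)
shift-Gt⁺ {u = u} s ((len , pos , lk) , a<u) =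
  (trans (length-map (s +_) u) len ,
   AllP.map⁺ (All.map (λ {x} 1≤x → ≤-trans 1≤x (m≤n+m x s)) pos) ,
   LinkedP.map⁺ (Linked.map (+-monoʳ-< s) lk)) ,
  AllP.map⁺ (All.map (+-monoʳ-< s) a<u)

shift-Gt⁻ : ∀ {a e u} s → IsESubGt (s + a) e (shift s u) → IsESubGt a e u
shift-Gt⁻ {a} {u = u} s ((len , _ , lk) , a<u) =
  (trans (sym (length-map (s +_) u)) len ,
   All.map (≤-trans (s≤s z≤n)) a<u′ ,
   Linked.map (+-cancelˡ-< s _ _) (LinkedP.map⁻ lk)) ,
  a<u′
  where
  a<u′ : All (a <_) u
  a<u′ = All.map (+-cancelˡ-< s _ _) (AllP.map⁻ a<u)

∈-shift⁻ : ∀ s {z a} → s + z ∈ shift s a → z ∈ a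
∈-shift⁻ s z∈ with ∈-map⁻ (s +_) z∈
... | x , x∈a , eq = subst (_∈ _) (sym (+-cancelˡ-≡ s _ _ eq)) x∈a

≺-shift⁺ : ∀ s {a b} → a ≺ b → shift s a ≺ shift s b
≺-shift⁺ s {a} {b} (x , x∈b , x∉a , above) = s + x , ∈-map⁺ (s +_) x∈b , (λ sx∈ → x∉a (∈-shift⁻ s sx∈)) , above′
  where
  above′ : ∀ y → s + x < y → (y ∈ shift s a ⇔ y ∈ shift s b)
  above′ y sx<y = mk⇔ (λ y∈ → back (∈-map⁺ (s +_) (to (above z x<z) (∈-shift⁻ s (forth y∈)))))
                      (λ y∈ → back (∈-map⁺ (s +_) (from (above z x<z) (∈-shift⁻ s (forth y∈)))))
    where
    z = y ∸ s
    s+z≡y : s + z ≡ y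
    s+z≡y = m+[n∸m]≡n (≤-trans (m≤m+n s x) (<⇒≤ sx<y))
    x<z : x < z
    x<z = +-cancelˡ-< s x z (subst (s + x <_) (sym s+z≡y) sx<y)
    forth : ∀ {c} → y ∈ shift s c → s + z ∈ shift s c
    forth = subst (_∈ _) (sym s+z≡y)
    back : ∀ {c} → s + z ∈ shift s c → y ∈ shift s c
    back = subst (_∈ _) s+z≡y

≺-shift⁻ : ∀ s {a b} → shift s a ≺ shift s b → a ≺ b
≺-shift⁻ s (x , x∈ , x∉ , above) with ∈-map⁻ (s +_) x∈
... | x′ , x′∈b , refl = x′ , x′∈b , (λ x′∈a → x∉ (∈-map⁺ (s +_) x′∈a)) ,
      λ y x′<y → mk⇔ (λ y∈a → ∈-shift⁻ s (to (above (s + y) (+-monoʳ-< s x′<y)) (∈-map⁺ (s +_) y∈a)))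
                     (λ y∈b → ∈-shift⁻ s (from (above (s + y) (+-monoʳ-< s x′<y)) (∈-map⁺ (s +_) y∈b)))

smallest-shift⁺ : ∀ {a e n u} s → Smallest (IsESubGt a e) n u → Smallest (IsESubGt (s + a) e) n (shift s u)
smallest-shift⁺ {a} {e} {n} {u} s (uu , notAbove) = shift-Gt⁺ s uu , λ (L , uL , len , below) →
  notAbove (map (unshift s) L , unique-map-on (unshift s) inj below uL , trans (length-map _ L) len ,
            AllP.map⁺ (All.map pull below))
  where
  back : ∀ {v} → IsESubGt (s + a) e v → shift s (unshift s v) ≡ v
  back gv = shift-unshift s (Gt-above gv (m≤m+n s a))
  inj : InjectiveOn (λ v → IsESubGt (s + a) e v × v ≺ shift s u) (unshift s)
  inj (gx , _) (gy , _) eq = trans (sym (back gx)) (trans (cong (shift s) eq) (back gy))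
  pull : ∀ {v} → IsESubGt (s + a) e v × v ≺ shift s u → IsESubGt a e (unshift s v) × unshift s v ≺ u
  pull (gv , v≺) = shift-Gt⁻ s (subst (IsESubGt (s + a) e) (sym (back gv)) gv) ,
                   ≺-shift⁻ s (subst (_≺ shift s u) (sym (back gv)) v≺)

smallest-shift⁻ : ∀ {a e n u} s → Smallest (IsESubGt (s + a) e) n (shift s u) → Smallest (IsESubGt a e) n u
smallest-shift⁻ s (uu , notAbove) = shift-Gt⁻ s uu , λ (L , uL , len , below) →
  notAbove (map (shift s) L , UniqueP.map⁺ (shift-injective s) uL , trans (length-map _ L) len ,
            AllP.map⁺ (All.map (λ (gv , v≺u) → shift-Gt⁺ s gv , ≺-shift⁺ s v≺u) below))

IsESub⇔Gt0 : ∀ {e} v → IsESub e v ⇔ IsESubGt 0 e v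
IsESub⇔Gt0 v = mk⇔ (λ ev → ev , proj₁ (proj₂ ev)) proj₁

Gt0⇔IsESub : ∀ {e} v → IsESubGt 0 e v ⇔ IsESub e v
Gt0⇔IsESub v = mk⇔ proj₁ (λ ev → ev , proj₁ (proj₂ ev))

smallest-translate⁺ : ∀ {k e n x} → Smallest (IsESub e) n x → Smallest (IsESubGt k e) n (shift k x)
smallest-translate⁺ {k} {e} {n} {x} sm =
  subst (λ b → Smallest (IsESubGt b e) n (shift k x)) (+-identityʳ k) (smallest-shift⁺ k (smallest-resp IsESub⇔Gt0 sm))

smallest-translate⁻ : ∀ {k e n x} → Smallest (IsESubGt k e) n (shift k x) → Smallest (IsESub e) n x
smallest-translate⁻ {k} {e} {n} {x} sm =
  smallest-resp Gt0⇔IsESub (smallest-shift⁻ k (subst (λ b → Smallest (IsESubGt b e) n (shift k x)) (sym (+-identityʳ k)) sm))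

C-↑ : ∀ {A B : Fam} {k e} → (∀ v → B v ⇔ (∃[ y ] (A y × v ≡ shift k y))) → ∀ y → C e A y → Cgt k e B (shift k y)
C-↑ {k = k} B≡A↑ y (n , hc , sm) = n , HasCard-image (shift k) (λ _ _ → shift-injective k) B≡A↑ hc , smallest-translate⁺ sm

module _ {A : Fam} {k e : ℕ} (famA : FamOfGt k e A) where

  translate-down : ∀ {u} → A u → shift k (unshift k u) ≡ u
  translate-down au = shift-unshift k (Gt-above (famA _ au) ≤-refl)

  ↓-members : ∀ v → (A ↓ k) v ⇔ (∃[ u ] (A u × v ≡ unshift k u))
  ↓-members v = mk⇔ (λ av → shift k v , av , sym (unshift-shift k v))
                    (λ (u , au , v≡) → subst A (sym (trans (cong (shift k) v≡) (translate-down au))) au)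

  unshift-injectiveOn : InjectiveOn A (unshift k)
  unshift-injectiveOn ax ay eq = trans (sym (translate-down ax)) (trans (cong (shift k) eq) (translate-down ay))

  famOf-↓ : FamOf e (A ↓ k)
  famOf-↓ v av = proj₁ (shift-Gt⁻ k (subst (λ b → IsESubGt b e (shift k v)) (sym (+-identityʳ k)) (famA _ av)))

  finite-↓ : Finite A → Finite (A ↓ k)
  finite-↓ (n , hc) = n , HasCard-image (unshift k) unshift-injectiveOn ↓-members hc

  Cgt-↓ : (Cgt k e A ↓ k) ⊆F C e (A ↓ k)
  Cgt-↓ x (n , hc , sm) = n , HasCard-image (unshift k) unshift-injectiveOn ↓-members hc , smallest-translate⁻ sm

  Inc-↓ : ∀ v → Inc A v ⇔ (∃[ y ] (Inc (A ↓ k) y × v ≡ shift k y))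
  Inc-↓ v = mk⇔ into outof
    where
    into : Inc A v → ∃[ y ] (Inc (A ↓ k) y × v ≡ shift k y)
    into incv with Inc-normal famA incv
    ... | u , au , t , k<t , refl =
      map (cut (t ∸ k)) (unshift k u) ,
      cut-∈Inc (t ∸ k) (subst A (sym (translate-down au)) au) ,
      (begin
        map (cut t) u                                       ≡⟨ cong₂ (λ t′ u′ → map (cut t′) u′) (sym (m+[n∸m]≡n (<⇒≤ k<t))) (sym (translate-down au)) ⟩
        map (cut (k + (t ∸ k))) (shift k (unshift k u))     ≡⟨ sym (shift-cut k (t ∸ k) (unshift k u)) ⟩
        shift k (map (cut (t ∸ k)) (unshift k u))           ∎)
      where open ≡-Reasoning
    outof : ∃[ y ] (Inc (A ↓ k) y × v ≡ shift k y) → Inc A v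
    outof (y , incy , refl) with Inc-normal (FamOf⇒FamOfGt0 famOf-↓) incy
    ... | u , au , t , _ , refl = subst (Inc A) (sym (shift-cut k t u)) (cut-∈Inc (k + t) au)

IncCompatible : ℕ → Set₁
IncCompatible e = ∀ (G : Fam) → FamOf e G → Finite G → Inc (C e G) ⊆F C e (Inc G)

IncCompatibleGt : ℕ → ℕ → Set₁
IncCompatibleGt k e = ∀ (G : Fam) → FamOfGt k e G → Finite G → Inc (Cgt k e G) ⊆F Cgt k e (Inc G)

Cgt-famOf : ∀ {k e G} → FamOfGt k e (Cgt k e G)
Cgt-famOf u (_ , _ , uu , _) = uu

-- Part (i), for every k ≥ 0: translate down by k, apply the hypothesis, translate back.
compatible-above : ∀ e → IncCompatible e → ∀ k → IncCompatibleGt k e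
compatible-above e hyp k G famG finG w incw with to (Inc-↓ Cgt-famOf w) incw
... | y , incy , refl =
  C-↑ (Inc-↓ famG) y (hyp (G ↓ k) (famOf-↓ famG) (finite-↓ famG finG) y (Inc-mono (Cgt-↓ famG) y incy))

-- Sections of Inc(F)

cut-Gt : ∀ t {k e u} → IsESubGt k e u → IsESubGt k e (map (cut t) u)
cut-Gt t {u = u} ((len , pos , lk) , k<u) =
  (trans (length-map (cut t) u) len ,
   AllP.map⁺ (All.map (λ {j} 1≤j → ≤-trans 1≤j (cut-≥ t j)) pos) ,
   LinkedP.map⁺ (Linked.map (cut-mono t) lk)) ,
  AllP.map⁺ (All.map (λ {j} k<j → <-≤-trans k<j (cut-≥ t j)) k<u)

A⊆IncA : ∀ {A : Fam} → A ⊆F Inc A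
A⊆IncA u au = u , au , id , (λ j 1≤j → 1≤j , n<1+n j , n≤1+n j) , sym (map-id u)

-- An insertion above k fixes k, so Inc(F̂_{1,k}) ⊆ (Inc F)^_{1,k}.
Inc-Hat1 : ∀ {F} d k → Inc (Hat1 d k F) ⊆F Hat1 d k (Inc F)
Inc-Hat1 {F} d k v incv with Inc-normal {k = k} {e = d ∸ 1} (λ u (eu , _ , k<u) → eu , k<u) incv
... | u , (eu , fku , k<u) , t , k<t , refl =
  proj₁ (cut-Gt t (eu , k<u)) ,
  subst (Inc F) (cong (_∷ map (cut t) u) (cut-lt k<t)) (cut-∈Inc t fku) ,
  proj₂ (cut-Gt t (eu , k<u))

Hat1-suc : ∀ {F} d k u → Hat1 d k F u → Hat1 d (suc k) (Inc F) (shift 1 u)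
Hat1-suc {F} d k u (eu , fku , k<u) =
  proj₁ (shift-Gt⁺ 1 (eu , k<u)) ,
  subst (Inc F) (map-cut-ge (All.tabulate (λ _ → z≤n))) (cut-∈Inc 0 fku) ,
  proj₂ (shift-Gt⁺ 1 (eu , k<u))

Hatd-Inc : ∀ {F} d k → Hatd d k F ⊆F Hatd d k (Inc F)
Hatd-Inc d k u (eu , fuk , u<k) = eu , A⊆IncA _ fuk , u<k

-- Inc(F̂_{d,k}) ⊆ (Inc F)^_{d,k+1}: cut t (û) ∪ {k+1} is cut (t ⊓ k) (û ∪ {k}).
Inc-Hatd : ∀ {F} d k → Inc (Hatd d k F) ⊆F Hatd d (suc k) (Inc F)
Inc-Hatd {F} d k v incv with Inc-normal (FamOf⇒FamOfGt0 {d ∸ 1} λ u (eu , _) → eu) incv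
... | u , (eu , fuk , u<k) , t , _ , refl =
  proj₁ (cut-Gt t (eu , proj₁ (proj₂ eu))) ,
  subst (Inc F) capped (cut-∈Inc (t ⊓ k) fuk) ,
  AllP.map⁺ (All.map (λ {j} j<k → s≤s (≤-trans (cut-≤ t j) j<k)) u<k)
  where
  open ≡-Reasoning
  capped : map (cut (t ⊓ k)) (u ++ [ k ]) ≡ map (cut t) u ++ [ suc k ]
  capped = begin
    map (cut (t ⊓ k)) (u ++ [ k ])         ≡⟨ map-++ (cut (t ⊓ k)) u [ k ] ⟩
    map (cut (t ⊓ k)) u ++ [ cut (t ⊓ k) k ] ≡⟨ cong₂ (λ a b → a ++ [ b ]) (map-cong-local (All.map (cut-⊓ t) u<k)) (cut-ge (m⊓n≤n t k)) ⟩
    map (cut t) u ++ [ suc k ]              ∎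

-- π(k ∪ û) is k ∪ π(û) when π fixes k (use part (i) on F̂_{1,k}),
-- and (k+1) ∪ (û + 1) when π moves k (translate û by one).
left-compression : ∀ d → (∀ k → IncCompatibleGt k (d ∸ 1)) →
                   ∀ F → FamOf d F → Finite F → Inc (Cl d F) ⊆F Cl d (Inc F)
left-compression d partI F famF finF _ (_ , (k , 1≤k , û , refl , cg@(n , hc , sm)) , π , hπ , refl)
  with inc1-cases hπ k 1≤k
... | inj₁ πk≡k =
  k , 1≤k , map π û , cong (_∷ map π û) πk≡k ,
  smallest-grow (finite-Hat1 d k (finite-Inc d famF finF)) id (Inc-Hat1 d k) (λ _ _ → id)
    (partI k (Hat1 d k F) (λ u (eu , _ , k<u) → eu , k<u) (finite-Hat1 d k finF) (map π û) (û , cg , π , hπ , refl))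
... | inj₂ πk≡1+k =
  suc k , s≤s z≤n , shift 1 û , cong₂ _∷_ πk≡1+k (inc1-shifts-above hπ 1≤k πk≡1+k (Gt-above (proj₁ sm) ≤-refl)) ,
  smallest-grow (finite-Hat1 d (suc k) (finite-Inc d famF finF)) (shift 1) (Hat1-suc d k) (λ _ _ → shift-injective 1) (n , hc , smallest-shift⁺ 1 sm)

-- π(û ∪ k) is û ∪ k when π fixes k (π then fixes û, whose entries are < k),
-- and π(û) ∪ (k+1) when π moves k (use the hypothesis on F̂_{d,k}).
right-compression : ∀ d → IncCompatible (d ∸ 1) →
                    ∀ F → FamOf d F → Finite F → Inc (Cr d F) ⊆F Cr d (Inc F)
right-compression d hyp F famF finF _ (_ , (k , 1≤k , û , refl , cg@(n , hc , sm)) , π , hπ , refl)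
  with inc1-cases hπ k 1≤k
... | inj₁ πk≡k =
  k , 1≤k , û , trans (map-++ π û [ k ]) (cong₂ (λ a b → a ++ [ b ]) π-fixes-û πk≡k) ,
  smallest-grow (finite-Hatd d k (finite-Inc d famF finF)) id (Hatd-Inc d k) (λ _ _ → id) cg
  where
  û<k : All (_< k) û
  û<k = smallest-below sm hc (λ _ (ev , _) → ev) (λ _ (_ , _ , v<k) → v<k)
  π-fixes-û : map π û ≡ û
  π-fixes-û = inc1-fixes-below hπ πk≡k (proj₁ (proj₂ (proj₁ sm))) û<k
... | inj₂ πk≡1+k =
  suc k , s≤s z≤n , map π û , trans (map-++ π û [ k ]) (cong (λ b → map π û ++ [ b ]) πk≡1+k) ,
  smallest-grow (finite-Hatd d (suc k) (finite-Inc d famF finF)) id (Inc-Hatd d k) (λ _ _ → id)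
    (hyp (Hatd d k F) (λ _ (ev , _) → ev) (finite-Hatd d k finF) (map π û) (û , cg , π , hπ , refl))

lemma3p12 : (d : ℕ) → 2 ≤ d →
    (∀ (G : Fam) → FamOf (d ∸ 1) G → Finite G → Inc (C (d ∸ 1) G) ⊆F C (d ∸ 1) (Inc G)) →
    ((∀ (k : ℕ) → 1 ≤ k → ∀ (G : Fam) → FamOfGt k (d ∸ 1) G → Finite G →
        Inc (Cgt k (d ∸ 1) G) ⊆F Cgt k (d ∸ 1) (Inc G))
    × (∀ (F : Fam) → FamOf d F → Finite F →
        (Inc (Cl d F) ⊆F Cl d (Inc F)) × (Inc (Cr d F) ⊆F Cr d (Inc F))))
lemma3p12 d _ hyp =
  (λ k _ → partI k) ,
  (λ F famF finF → left-compression d partI F famF finF , right-compression d hyp F famF finF)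
  where
  partI : ∀ k → IncCompatibleGt k (d ∸ 1)
  partI = compatible-above (d ∸ 1) hyp
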